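{- Any deterministic online algorithm for load balancing of temporary tasks with predictions which is oblivious to the actual durations and based only on the estimations has competitive ratio at least $\Omega(\mu)$ for the maximum load ($\ell_\infty$-norm) objective, where $\mu$ is the distortion of the input.
   Context: Load balancing of temporary tasks with predictions: $m$ machines; jobs arrive online at integer time steps; job $j$ has arrival time $t_j$, actual integer duration $d_j\ge1$, and load $p_{ij}\in\mathbb{R}_+\cup\{\infty\}$ on machine $i$; it is alive during slots $t_j+1,\dots,t_j+d_j$. On arrival the algorithm learns $t_j$, the $p_{ij}$ and a real estimate $\tilde d_j\ge1$ of the duration and irrevocably assigns $j$ to a machine. With $\mu_1,\mu_2\ge1$ such that $d_j\in[\lceil\tilde d_j/\mu_2\rceil,\lfloor\mu_1\tilde d_j\rfloor]$ for all $j$, the distortion is $\mu=\mu_1\mu_2$. The objective is $\max_t\max_i\ell_i(t)$, where $\ell_i(t)$ is the total load of alive jobs assigned to machine $i$ at slot $t$. An algorithm is oblivious to the actual durations if its assignment decisions depend only on the arrival times, loads and estimates $\tilde d_j$ of the jobs seen so far, and not on the observed departures (actual durations) of jobs. The competitive ratio is the worst-case ratio of the algorithm's objective value to the optimal offline objective value.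
   Formalization: The distortion μ ranges only over the rationals, and the loads $p_{ij}$ and estimates $\tilde d_j$ of the instances are taken in ℚ rather than in the reals. -}

module Defs where

open import Data.Nat as ℕ using (ℕ; zero; suc)
open import Data.Nat.Properties using (<⇒≤)
open import Data.Integer using (+_)
open import Data.Fin as Fin using (Fin; toℕ; inject≤)
open import Data.Fin.Properties using (toℕ<n)
open import Data.Rational using (ℚ; 0ℚ; 1ℚ; _+_; _*_; _≤_; _<_; _/_)
open import Data.Maybe using (Maybe; just; nothing; fromMaybe)
open import Data.Bool using (Bool; if_then_else_; _∧_)
open import Data.List using (List; foldr; map; allFin)
open import Data.Product using (Σ; ∃; _×_; _,_)
open import Data.Sum using (_⊎_)
open import Relation.Nullary using (¬_; does)
open import Relation.Binary.PropositionalEquality using (_≡_)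

ℕtoℚ : ℕ → ℚ
ℕtoℚ n = (+ n) / 1

-- What the algorithm sees on arrival of a job (on m machines):
-- arrival time t_j, loads p_ij (nothing = ∞), estimate d̃_j.
record Obs (m : ℕ) : Set where
  field
    arrival  : ℕ
    load     : Fin m → Maybe ℚ
    estimate : ℚ
open Obs public

record Job (m : ℕ) : Set where
  field
    obs      : Obs m
    duration : ℕ
open Job public

-- An instance on m machines: n jobs, listed in arrival (= processing) order.
record Instance (m : ℕ) : Set where
  field
    size : ℕ
    job  : Fin size → Job m
open Instance public

Valid : ∀ {m} → Instance m → Set
Valid {m} I =
  (∀ k → 1 ℕ.≤ duration (job I k)) ×
  (∀ k → 1ℚ ≤ estimate (obs (job I k))) ×
  (∀ k (i : Fin m) (q : ℚ) → load (obs (job I k)) i ≡ just q → 0ℚ ≤ q) ×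
  (∀ k k' → toℕ k ℕ.≤ toℕ k' → arrival (obs (job I k)) ℕ.≤ arrival (obs (job I k')))

-- d_j ∈ [⌈d̃_j/μ₂⌉, ⌊μ₁ d̃_j⌋]; since d_j is an integer this is exactly
-- d̃_j/μ₂ ≤ d_j ≤ μ₁ d̃_j, written multiplicatively (μ₂ > 0).
Consistent : ∀ {m} → ℚ → ℚ → Instance m → Set
Consistent μ₁ μ₂ I = ∀ k →
  (estimate (obs (job I k)) ≤ μ₂ * ℕtoℚ (duration (job I k))) ×
  (ℕtoℚ (duration (job I k)) ≤ μ₁ * estimate (obs (job I k)))

Assignment : ∀ {m} → Instance m → Set
Assignment {m} I = Fin (size I) → Fin m

Feasible : ∀ {m} (I : Instance m) → Assignment I → Set
Feasible I σ = ∀ k → ∃ λ q → load (obs (job I k)) (σ k) ≡ just q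

alive : ∀ {m} → Job m → ℕ → Bool
alive j t = does (suc (arrival (obs j)) ℕ.≤? t)
          ∧ does (t ℕ.≤? arrival (obs j) ℕ.+ duration j)

-- ℓ_i(t): total load of alive jobs assigned to machine i at slot t
-- (infinite loads contribute 0 here; they only occur for infeasible σ).
machineLoad : ∀ {m} (I : Instance m) → Assignment I → Fin m → ℕ → ℚ
machineLoad I σ i t =
  foldr _+_ 0ℚ (map contrib (allFin (size I)))
  where
  contrib : Fin (size I) → ℚ
  contrib k = if does (σ k Fin.≟ i) ∧ alive (job I k) t
              then fromMaybe 0ℚ (load (obs (job I k)) i)
              else 0ℚ

IsOpt : ∀ {m} → Instance m → ℚ → Set
IsOpt {m} I v =
  (∃ λ (σ : Assignment I) → Feasible I σ × (∀ t (i : Fin m) → machineLoad I σ i t ≤ v)) ×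
  (∀ (σ : Assignment I) → Feasible I σ → ∃ λ t → ∃ λ (i : Fin m) → v ≤ machineLoad I σ i t)

ObjAtLeast : ∀ {m} (I : Instance m) → Assignment I → ℚ → Set
ObjAtLeast {m} I σ x =
  ¬ Feasible I σ ⊎ (∃ λ t → ∃ λ (i : Fin m) → x ≤ machineLoad I σ i t)

-- A deterministic online algorithm on m machines that is oblivious to the
-- actual durations: the machine for the current job is a function of the
-- observations (arrival, loads, estimate) of the k previously arrived jobs
-- and of the current job only.
OblAlg : ℕ → Set
OblAlg m = (k : ℕ) → (Fin k → Obs m) → Obs m → Fin m

runAlg : ∀ {m} → OblAlg m → (I : Instance m) → Assignment I
runAlg A I k =
  A (toℕ k) (λ h → obs (job I (inject≤ h (<⇒≤ (toℕ<n k))))) (obs (job I k))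

{-# OPTIONS --safe #-}

-- On 2K machines, K identical jobs (load 1 everywhere, estimate 1) arrive in each of the rounds
-- 0, …, 2K − 2. An algorithm blind to actual durations assigns them identically whatever the
-- durations are, so by pigeonhole one machine receives K of the (2K − 1)K jobs whatever we choose.
-- Those K jobs get duration 2K − 1 and all others duration 1: the algorithm then carries load K
-- at time 2K − 1, while the optimum is 1 (the short jobs of a round go to K machines by position,
-- the long jobs to the other K machines, one each). Here μ₁ = μ ≥ 2K − 1 and μ₂ = 1, and K is
-- chosen with μ ≤ 3K, so the ratio is at least μ/3.

module Submission where

open import Data.Bool using (Bool; true; false; T; _∧_; if_then_else_)
open import Data.Bool.Properties using (T-∧)
open import Data.Empty using (⊥-elim)
open import Data.Fin as Fin using (Fin; zero; suc; toℕ; _≟_; quotient; remainder; combine; join; splitAt)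
open import Data.Fin.Properties
  using (suc-injective; 0≢1+n; ¬∀⟶∃¬; toℕ<n; toℕ-injective; combine-remQuot; combine-monoˡ-<; splitAt-join)
open import Data.Integer as ℤ using (+_; -[1+_])
import Data.Integer.Properties as ℤ
open import Data.List as List using (foldr; map; allFin)
open import Data.List.Properties using (map-tabulate; tabulate-cong)
open import Data.Maybe as Maybe using (Maybe; just; nothing; is-just; maybe′)
open import Data.Nat as ℕ using (ℕ; zero; suc; z≤n; s≤s)
import Data.Nat.Properties as ℕ
open import Algebra.Properties.CommutativeMonoid.Sum ℕ.+-0-commutativeMonoid
  using (sum; ∑-comm; sum-cong-≗; sum-replicate-zero)
open import Data.Nat.Coprimality as Coprimality using (Coprime; 1-coprimeTo)
open import Data.Nat.DivMod using (m≡m%n+[m/n]*n; m%n<n)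
open import Data.Nat.Solver using (module +-*-Solver)
open import Data.Product using (∃; _×_; _,_; proj₁; proj₂; map₂)
open import Data.Rational using (ℚ; mkℚ; 0ℚ; 1ℚ; _+_; _*_; _≤_; _<_; _/_; *≤*)
import Data.Rational.Properties as ℚ
open import Data.Sum using (_⊎_; inj₁; inj₂)
open import Data.Sum.Properties using (inj₁-injective; inj₂-injective)
open import Function using (_∘_; const; id; _⇔_; mk⇔; Equivalence)
open import Relation.Nullary using (Dec; yes; no; does; ¬_)
open import Relation.Binary.PropositionalEquality

open import Defs

open Equivalence using (to; from)

T-does⁻ : ∀ {a} {A : Set a} (a? : Dec A) → T (does a?) → A
T-does⁻ (yes a) _ = a

T-does⁺ : ∀ {a} {A : Set a} (a? : Dec A) → A → T (does a?)
T-does⁺ (yes _) _ = _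
T-does⁺ (no ¬a) a = ¬a a

count : ∀ {n} → (Fin n → Bool) → ℕ
count b = sum (λ j → if b j then 1 else 0)

count-mono : ∀ {n} (b b′ : Fin n → Bool) → (∀ j → T (b j) → T (b′ j)) → count b ℕ.≤ count b′
count-mono {zero}  b b′ b⊆b′ = z≤n
count-mono {suc n} b b′ b⊆b′ with b zero | b′ zero | b⊆b′ zero
... | true  | true  | _  = s≤s (count-mono (b ∘ suc) (b′ ∘ suc) (b⊆b′ ∘ suc))
... | true  | false | ⊆₀ = ⊥-elim (⊆₀ _)
... | false | _     | _  = ℕ.≤-trans (count-mono (b ∘ suc) (b′ ∘ suc) (b⊆b′ ∘ suc)) (ℕ.m≤n+m _ _)

count-false : ∀ n → count {n} (const false) ≡ 0
count-false = sum-replicate-zero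

count-true : ∀ n → count {n} (const true) ≡ n
count-true zero    = refl
count-true (suc n) = cong suc (count-true n)

count-≟ : ∀ {n} (x : Fin n) → count (λ i → does (x ≟ i)) ≡ 1
count-≟ {suc n} zero    = cong suc (count-false n)
count-≟ {suc n} (suc x) = count-≟ x

count-≥1 : ∀ {n} (b : Fin n → Bool) j → T (b j) → 1 ℕ.≤ count b
count-≥1 b j bj = subst (ℕ._≤ count b) (count-≟ j)
  (count-mono _ b λ i j≡i → subst (T ∘ b) (T-does⁻ (j ≟ i) j≡i) bj)

count-≤1 : ∀ {n} (b : Fin n → Bool) → (∀ j j′ → T (b j) → T (b j′) → j ≡ j′) → count b ℕ.≤ 1
count-≤1 {zero}  b unique = z≤n
count-≤1 {suc n} b unique with b zero in b₀
... | true  = s≤s (subst (count (b ∘ suc) ℕ.≤_) (count-false n) (count-mono (b ∘ suc) (const false)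
                λ j bj → 0≢1+n (unique zero (suc j) (subst T (sym b₀) _) bj)))
... | false = count-≤1 (b ∘ suc) λ j j′ bj bj′ → suc-injective (unique (suc j) (suc j′) bj bj′)

sum-≤-* : ∀ {n k} (f : Fin n → ℕ) → (∀ i → f i ℕ.≤ k) → sum f ℕ.≤ n ℕ.* k
sum-≤-* {zero}  f f≤k = z≤n
sum-≤-* {suc n} f f≤k = ℕ.+-mono-≤ (f≤k zero) (sum-≤-* (f ∘ suc) (f≤k ∘ suc))

fibre : ∀ {m n} → (Fin n → Fin m) → Fin m → Fin n → Bool
fibre σ i j = does (σ j ≟ i)

sum-count-fibre : ∀ {m n} (σ : Fin n → Fin m) → sum (count ∘ fibre σ) ≡ n
sum-count-fibre {m} {n} σ = begin
  sum (count ∘ fibre σ)                     ≡⟨ ∑-comm (λ i j → if fibre σ i j then 1 else 0) ⟩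
  sum (λ j → count (λ i → does (σ j ≟ i)))  ≡⟨ sum-cong-≗ (count-≟ ∘ σ) ⟩
  count {n} (const true)                    ≡⟨ count-true n ⟩
  n                                         ∎
  where open ≡-Reasoning

pigeonhole-fibre : ∀ {m n k} (σ : Fin n → Fin m) → m ℕ.* k ℕ.< n → ∃ λ i → k ℕ.< count (fibre σ i)
pigeonhole-fibre {m} {n} {k} σ mk<n =
  map₂ ℕ.≰⇒> (¬∀⟶∃¬ m (λ i → count (fibre σ i) ℕ.≤ k) (λ i → count (fibre σ i) ℕ.≤? k) all-small)
  where
  all-small : ¬ (∀ i → count (fibre σ i) ℕ.≤ k)
  all-small small = ℕ.<⇒≱ mk<n (subst (ℕ._≤ m ℕ.* k) (sum-count-fibre σ) (sum-≤-* (count ∘ fibre σ) small))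

pick : ∀ {n} c → (Fin n → Bool) → Fin n → Maybe (Fin c)
pick         zero    b _       = nothing
pick {suc n} (suc c) b zero    = if b zero then just zero else nothing
pick {suc n} (suc c) b (suc j) =
  if b zero then Maybe.map Fin.suc (pick c (b ∘ suc) j) else pick (suc c) (b ∘ suc) j

picked : ∀ {n} c → (Fin n → Bool) → Fin n → Bool
picked c b = is-just ∘ pick c b

is-just-map-suc : ∀ {c} (x : Maybe (Fin c)) → is-just (Maybe.map Fin.suc x) ≡ is-just x
is-just-map-suc (just _) = refl
is-just-map-suc nothing  = refl

picked⇒T : ∀ {n} c (b : Fin n → Bool) j → T (picked c b j) → T (b j)
picked⇒T {suc n} (suc c) b zero    p with b zero
... | true  = _
picked⇒T {suc n} (suc c) b (suc j) p with b zero
... | true  = picked⇒T c (b ∘ suc) j (subst T (is-just-map-suc (pick c (b ∘ suc) j)) p)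
... | false = picked⇒T (suc c) (b ∘ suc) j p

pick-injective : ∀ {n} c (b : Fin n → Bool) j j′ {r} → pick c b j ≡ just r → pick c b j′ ≡ just r → j ≡ j′
pick-injective {suc n} (suc c) b zero    zero     eq eq′ = refl
pick-injective {suc n} (suc c) b zero    (suc j′) eq eq′ with b zero | eq
... | true | refl with pick c (b ∘ suc) j′ | eq′
...   | nothing | ()
...   | just _  | ()
pick-injective {suc n} (suc c) b (suc j) zero eq eq′ = sym (pick-injective (suc c) b zero (suc j) eq′ eq)
pick-injective {suc n} (suc c) b (suc j) (suc j′) eq eq′ with b zero
... | false = cong suc (pick-injective (suc c) (b ∘ suc) j j′ eq eq′)
... | true with pick c (b ∘ suc) j in e | pick c (b ∘ suc) j′ in e′ | eq | eq′
...   | just _ | just _ | refl | refl = cong suc (pick-injective c (b ∘ suc) j j′ e e′)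

count-picked : ∀ {n} c (b : Fin n → Bool) → c ℕ.≤ count b → c ℕ.≤ count (picked c b)
count-picked zero b _ = z≤n
count-picked {suc n} (suc c) b c≤ with b zero
... | true  = s≤s (ℕ.≤-trans (count-picked c (b ∘ suc) (ℕ.≤-pred c≤))
                   (count-mono _ (is-just ∘ Maybe.map Fin.suc ∘ pick c (b ∘ suc))
                     λ j p → subst T (sym (is-just-map-suc (pick c (b ∘ suc) j))) p))
... | false = count-picked (suc c) (b ∘ suc) c≤

quotient-mono : ∀ {m} n {i j : Fin (m ℕ.* n)} →
                toℕ i ℕ.≤ toℕ j → toℕ (quotient {m} n i) ℕ.≤ toℕ (quotient {m} n j)
quotient-mono {m} n {i} {j} i≤j = ℕ.≮⇒≥ λ qj<qi →
  ℕ.<⇒≱ (subst₂ Fin._<_ (combine-remQuot {m} n j) (combine-remQuot {m} n i)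
           (combine-monoˡ-< (remainder {m} n j) (remainder {m} n i) qj<qi)) i≤j

quotient-remainder-injective : ∀ {m} n {i j : Fin (m ℕ.* n)} →
  quotient {m} n i ≡ quotient n j → remainder {m} n i ≡ remainder {m} n j → i ≡ j
quotient-remainder-injective {m} n {i} {j} q≡ r≡ =
  trans (sym (combine-remQuot {m} n i)) (trans (cong₂ (combine {m}) q≡ r≡) (combine-remQuot {m} n j))

join-injective : ∀ m n {x y : Fin m ⊎ Fin n} → join m n x ≡ join m n y → x ≡ y
join-injective m n {x} {y} eq =
  trans (sym (splitAt-join m n x)) (trans (cong (splitAt m) eq) (splitAt-join m n y))

ℕtoℚ≡mkℚ : ∀ n → ℕtoℚ n ≡ mkℚ (+ n) 0 (Coprimality.sym (1-coprimeTo n))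
ℕtoℚ≡mkℚ n = ℚ.normalize-coprime (Coprimality.sym (1-coprimeTo n))

ℕtoℚ-homo-+ : ∀ m n → ℕtoℚ (m ℕ.+ n) ≡ ℕtoℚ m + ℕtoℚ n
ℕtoℚ-homo-+ m n rewrite ℕtoℚ≡mkℚ m | ℕtoℚ≡mkℚ n =
  cong (_/ 1) (sym (cong₂ ℤ._+_ (ℤ.*-identityʳ (+ m)) (ℤ.*-identityʳ (+ n))))

ℕtoℚ-homo-* : ∀ m n → ℕtoℚ (m ℕ.* n) ≡ ℕtoℚ m * ℕtoℚ n
ℕtoℚ-homo-* m n rewrite ℕtoℚ≡mkℚ m | ℕtoℚ≡mkℚ n = cong (_/ 1) (ℤ.pos-* m n)

ℕtoℚ≤mkℚ : ∀ {n a d} .{c : Coprime a (suc d)} → n ℕ.* suc d ℕ.≤ a → ℕtoℚ n ≤ mkℚ (+ a) d c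
ℕtoℚ≤mkℚ {n} {a} {d} le rewrite ℕtoℚ≡mkℚ n =
  *≤* (subst₂ ℤ._≤_ (ℤ.pos-* n (suc d)) (sym (ℤ.*-identityʳ (+ a))) (ℤ.+≤+ le))

ℕtoℚ≤mkℚ⁻¹ : ∀ {n a d} .{c : Coprime a (suc d)} → ℕtoℚ n ≤ mkℚ (+ a) d c → n ℕ.* suc d ℕ.≤ a
ℕtoℚ≤mkℚ⁻¹ {n} {a} {d} le rewrite ℕtoℚ≡mkℚ n with le
... | *≤* le′ = ℤ.drop‿+≤+ (subst₂ ℤ._≤_ (sym (ℤ.pos-* n (suc d))) (ℤ.*-identityʳ (+ a)) le′)

mkℚ≤ℕtoℚ : ∀ {n a d} .{c : Coprime a (suc d)} → a ℕ.≤ n ℕ.* suc d → mkℚ (+ a) d c ≤ ℕtoℚ n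
mkℚ≤ℕtoℚ {n} {a} {d} le rewrite ℕtoℚ≡mkℚ n =
  *≤* (subst₂ ℤ._≤_ (sym (ℤ.*-identityʳ (+ a))) (ℤ.pos-* n (suc d)) (ℤ.+≤+ le))

ℕtoℚ-mono-≤ : ∀ {m n} → m ℕ.≤ n → ℕtoℚ m ≤ ℕtoℚ n
ℕtoℚ-mono-≤ {m} {n} le rewrite ℕtoℚ≡mkℚ n = ℕtoℚ≤mkℚ {m} (subst (ℕ._≤ n) (sym (ℕ.*-identityʳ m)) le)

ℕtoℚ-sum : ∀ {n} (f : Fin n → ℕ) → foldr _+_ 0ℚ (List.tabulate (ℕtoℚ ∘ f)) ≡ ℕtoℚ (sum f)
ℕtoℚ-sum {zero}  f = refl
ℕtoℚ-sum {suc n} f =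
  trans (cong (_+_ (ℕtoℚ (f zero))) (ℕtoℚ-sum (f ∘ suc))) (sym (ℕtoℚ-homo-+ (f zero) (sum (f ∘ suc))))

ℕtoℚ-count : ∀ {n} (b : Fin n → Bool) →
             foldr _+_ 0ℚ (map (λ j → if b j then 1ℚ else 0ℚ) (allFin n)) ≡ ℕtoℚ (count b)
ℕtoℚ-count {n} b = begin
  foldr _+_ 0ℚ (map indicator (allFin n))
    ≡⟨ cong (foldr _+_ 0ℚ) (map-tabulate id indicator) ⟩
  foldr _+_ 0ℚ (List.tabulate indicator)
    ≡⟨ cong (foldr _+_ 0ℚ) (tabulate-cong (ℕtoℚ-if ∘ b)) ⟩
  foldr _+_ 0ℚ (List.tabulate (λ j → ℕtoℚ (if b j then 1 else 0)))
    ≡⟨ ℕtoℚ-sum (λ j → if b j then 1 else 0) ⟩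
  ℕtoℚ (count b)
    ∎
  where
  open ≡-Reasoning
  indicator : Fin n → ℚ
  indicator j = if b j then 1ℚ else 0ℚ
  ℕtoℚ-if : ∀ x → (if x then 1ℚ else 0ℚ) ≡ ℕtoℚ (if x then 1 else 0)
  ℕtoℚ-if true  = refl
  ℕtoℚ-if false = refl

multiple-bracket : ∀ a d → suc d ℕ.≤ a →
                   ∃ λ k → (suc k ℕ.+ k) ℕ.* suc d ℕ.≤ a × a ℕ.≤ 3 ℕ.* suc k ℕ.* suc d
multiple-bracket a d b≤a with e , refl ← ℕ.m≤n⇒∃[o]m+o≡n b≤a = k , lower , upper
  where
  open +-*-Solver
  open ℕ.≤-Reasoning
  b k r : ℕ
  b = suc d
  k = e ℕ./ (b ℕ.+ b)
  r = e ℕ.% (b ℕ.+ b)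
  e≡ : e ≡ r ℕ.+ k ℕ.* (b ℕ.+ b)
  e≡ = m≡m%n+[m/n]*n e (b ℕ.+ b)
  lower : (suc k ℕ.+ k) ℕ.* b ℕ.≤ b ℕ.+ e
  lower = begin
    (suc k ℕ.+ k) ℕ.* b            ≡⟨ solve 2 (λ k b → (con 1 :+ k :+ k) :* b := b :+ k :* (b :+ b)) refl k b ⟩
    b ℕ.+ k ℕ.* (b ℕ.+ b)          ≤⟨ ℕ.+-monoʳ-≤ b (ℕ.m≤n+m _ r) ⟩
    b ℕ.+ (r ℕ.+ k ℕ.* (b ℕ.+ b))  ≡⟨ cong (b ℕ.+_) e≡ ⟨
    b ℕ.+ e                        ∎
  upper : b ℕ.+ e ℕ.≤ 3 ℕ.* suc k ℕ.* b
  upper = begin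
    b ℕ.+ e                                           ≡⟨ cong (b ℕ.+_) e≡ ⟩
    b ℕ.+ (r ℕ.+ k ℕ.* (b ℕ.+ b))                     ≤⟨ ℕ.+-monoʳ-≤ b (ℕ.+-monoˡ-≤ _ (ℕ.<⇒≤ (m%n<n e (b ℕ.+ b)))) ⟩
    b ℕ.+ ((b ℕ.+ b) ℕ.+ k ℕ.* (b ℕ.+ b))             ≤⟨ ℕ.m≤m+n _ (k ℕ.* b) ⟩
    b ℕ.+ ((b ℕ.+ b) ℕ.+ k ℕ.* (b ℕ.+ b)) ℕ.+ k ℕ.* b ≡⟨ solve 2 (λ k b → b :+ ((b :+ b) :+ k :* (b :+ b)) :+ k :* b
                                                                := con 3 :* (con 1 :+ k) :* b) refl k b ⟩
    3 ℕ.* suc k ℕ.* b                                 ∎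

μ-bracket : ∀ μ → 1ℚ ≤ μ → ∃ λ k → ℕtoℚ (suc k ℕ.+ k) ≤ μ × μ ≤ ℕtoℚ (3 ℕ.* suc k)
μ-bracket (mkℚ -[1+ _ ] _ _) (*≤* ())
μ-bracket (mkℚ (+ a) d _) 1≤μ
  with k , lower , upper ← multiple-bracket a d (subst (ℕ._≤ a) (ℕ.*-identityˡ (suc d)) (ℕtoℚ≤mkℚ⁻¹ {1} 1≤μ))
  = k , ℕtoℚ≤mkℚ {suc k ℕ.+ k} lower , mkℚ≤ℕtoℚ {3 ℕ.* suc k} upper

⅓ : ℚ
⅓ = + 1 / 3

⅓*≤ : ∀ {μ} n → μ ≤ ℕtoℚ (3 ℕ.* n) → ⅓ * μ ≤ ℕtoℚ n
⅓*≤ {μ} n μ≤ = begin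
  ⅓ * μ                  ≤⟨ ℚ.*-monoˡ-≤-nonNeg ⅓ μ≤ ⟩
  ⅓ * ℕtoℚ (3 ℕ.* n)     ≡⟨ cong (⅓ *_) (ℕtoℚ-homo-* 3 n) ⟩
  ⅓ * (ℕtoℚ 3 * ℕtoℚ n)  ≡⟨ ℚ.*-assoc ⅓ (ℕtoℚ 3) (ℕtoℚ n) ⟨
  ⅓ * ℕtoℚ 3 * ℕtoℚ n    ≡⟨ ℚ.*-identityˡ (ℕtoℚ n) ⟩
  ℕtoℚ n                 ∎
  where open ℚ.≤-Reasoning

alive⇔ : ∀ {m} (j : Job m) t →
         T (alive j t) ⇔ (arrival (obs j) ℕ.< t × t ℕ.≤ arrival (obs j) ℕ.+ duration j)
alive⇔ j t = mk⇔
  (λ h → let p , q = to T-∧ h in ℕ.≤ᵇ⇒≤ _ _ p , ℕ.≤ᵇ⇒≤ _ _ q)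
  (λ (p , q) → from T-∧ (ℕ.≤⇒≤ᵇ p , ℕ.≤⇒≤ᵇ q))

alive-after-arrival : ∀ {m} (j : Job m) → 1 ℕ.≤ duration j → T (alive j (suc (arrival (obs j))))
alive-after-arrival j d≥1 = from (alive⇔ j _)
  (ℕ.≤-refl , subst (ℕ._≤ arrival (obs j) ℕ.+ duration j) (ℕ.+-comm (arrival (obs j)) 1) (ℕ.+-monoʳ-≤ _ d≥1))

alive-unit : ∀ {m} (j : Job m) {t} → duration j ≡ 1 → T (alive j t) → t ≡ suc (arrival (obs j))
alive-unit j {t} d≡1 h with p , q ← to (alive⇔ j t) h =
  ℕ.≤-antisym (subst (t ℕ.≤_) (trans (cong (arrival (obs j) ℕ.+_) d≡1) (ℕ.+-comm (arrival (obs j)) 1)) q) p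

module Adversary (k : ℕ) where
  K M R : ℕ
  K = suc k
  M = K ℕ.+ K
  R = K ℕ.+ k

  arrivalOf : Fin (R ℕ.* K) → ℕ
  arrivalOf j = toℕ (quotient {R} K j)

  request : Fin (R ℕ.* K) → Obs M
  request j = record { arrival = arrivalOf j ; load = const (just 1ℚ) ; estimate = 1ℚ }

  instanceWith : (Fin (R ℕ.* K) → ℕ) → Instance M
  instanceWith d = record { size = R ℕ.* K ; job = λ j → record { obs = request j ; duration = d j } }

  machineLoad≡count : ∀ d σ i t →
    machineLoad (instanceWith d) σ i t ≡ ℕtoℚ (count (λ j → does (σ j ≟ i) ∧ alive (job (instanceWith d) j) t))
  machineLoad≡count d σ i t = ℕtoℚ-count (λ j → does (σ j ≟ i) ∧ alive (job (instanceWith d) j) t)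

  module _ (d : Fin (R ℕ.* K) → ℕ) (d≥1 : ∀ j → 1 ℕ.≤ d j) where

    valid : Valid (instanceWith d)
    valid = d≥1 , (λ _ → ℚ.≤-refl) , (λ { _ _ _ refl → ℚ.nonNegative⁻¹ 1ℚ }) , (λ _ _ → quotient-mono K)

    consistent : ∀ {μ D} → (∀ j → d j ℕ.≤ D) → ℕtoℚ D ≤ μ → Consistent μ 1ℚ (instanceWith d)
    consistent {μ} d≤D D≤μ j =
      subst (1ℚ ≤_) (sym (ℚ.*-identityˡ _)) (ℕtoℚ-mono-≤ (d≥1 j)) ,
      subst (ℕtoℚ (d j) ≤_) (sym (ℚ.*-identityʳ μ)) (ℚ.≤-trans (ℕtoℚ-mono-≤ (d≤D j)) D≤μ)

    some-load-≥1 : ∀ σ → ∃ λ t → ∃ λ i → 1ℚ ≤ machineLoad (instanceWith d) σ i t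
    some-load-≥1 σ = t , σ zero , subst (1ℚ ≤_) (sym (machineLoad≡count d σ (σ zero) t))
      (ℕtoℚ-mono-≤ (count-≥1 (λ j → does (σ j ≟ σ zero) ∧ alive (job (instanceWith d) j) t) zero
        (from T-∧ (T-does⁺ (σ zero ≟ σ zero) refl , alive-after-arrival (job (instanceWith d) zero) (d≥1 zero)))))
      where
      t : ℕ
      t = suc (arrivalOf zero)

  module Against (A : OblAlg M) where
    -- A never sees durations, so this is runAlg A (instanceWith d) for every d.
    assigned : Fin (R ℕ.* K) → Fin M
    assigned = runAlg A (instanceWith (const 1))

    crowded : ∃ λ i → K ℕ.≤ count (fibre assigned i)
    crowded = pigeonhole-fibre assigned (subst (M ℕ.* k ℕ.<_) (sym RK≡) (ℕ.m<m+n (M ℕ.* k) (s≤s z≤n)))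
      where
      open +-*-Solver
      RK≡ : R ℕ.* K ≡ M ℕ.* k ℕ.+ K
      RK≡ = solve 1 (λ k → (con 1 :+ k :+ k) :* (con 1 :+ k)
                        := (con 1 :+ k :+ (con 1 :+ k)) :* k :+ (con 1 :+ k)) refl k

    i* : Fin M
    i* = proj₁ crowded

    longLabel : Fin (R ℕ.* K) → Maybe (Fin K)
    longLabel = pick K (fibre assigned i*)

    durations : Fin (R ℕ.* K) → ℕ
    durations j = maybe′ (const R) 1 (longLabel j)

    I : Instance M
    I = instanceWith durations

    durations-≥1 : ∀ j → 1 ℕ.≤ durations j
    durations-≥1 j with longLabel j
    ... | just _  = s≤s z≤n
    ... | nothing = ℕ.≤-refl

    durations-≤R : ∀ j → durations j ℕ.≤ R
    durations-≤R j with longLabel j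
    ... | just _  = ℕ.≤-refl
    ... | nothing = s≤s z≤n

    slot : Fin (R ℕ.* K) → Fin K ⊎ Fin K
    slot j = maybe′ inj₂ (inj₁ (remainder {R} K j)) (longLabel j)

    optimal : Assignment I
    optimal = join K K ∘ slot

    short-arrival : ∀ {t} j → T (alive (job I j) t) → longLabel j ≡ nothing → t ≡ suc (arrivalOf j)
    short-arrival j a e = alive-unit (job I j) (cong (maybe′ (const R) 1) e) a

    slot-injective : ∀ {t} j j′ → T (alive (job I j) t) → T (alive (job I j′) t) → slot j ≡ slot j′ → j ≡ j′
    slot-injective {t} j j′ aj aj′ = by-label (short-arrival j aj) (short-arrival j′ aj′)
      where
      by-label : (longLabel j ≡ nothing → t ≡ suc (arrivalOf j)) →
                 (longLabel j′ ≡ nothing → t ≡ suc (arrivalOf j′)) →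
                 slot j ≡ slot j′ → j ≡ j′
      by-label tj tj′ eq with longLabel j in e | longLabel j′ in e′
      ... | just r  | just r′ =
            pick-injective K (fibre assigned i*) j j′ e (trans e′ (cong just (sym (inj₂-injective eq))))
      ... | nothing | nothing = quotient-remainder-injective K
            (toℕ-injective (ℕ.suc-injective (trans (sym (tj refl)) (tj′ refl)))) (inj₁-injective eq)

    optimal-≤1 : ∀ t i → machineLoad I optimal i t ≤ 1ℚ
    optimal-≤1 t i = subst (_≤ 1ℚ) (sym (machineLoad≡count durations optimal i t))
      (ℕtoℚ-mono-≤ (count-≤1 on-i-at-t unique))
      where
      on-i-at-t : Fin (R ℕ.* K) → Bool
      on-i-at-t j = does (optimal j ≟ i) ∧ alive (job I j) t
      unique : ∀ j j′ → T (on-i-at-t j) → T (on-i-at-t j′) → j ≡ j′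
      unique j j′ h h′ = let o , a = to T-∧ h ; o′ , a′ = to T-∧ h′ in
        slot-injective {t} j j′ a a′
          (join-injective K K (trans (T-does⁻ (optimal j ≟ i) o) (sym (T-does⁻ (optimal j′ ≟ i) o′))))

    isOpt : IsOpt I 1ℚ
    isOpt = (optimal , (λ _ → 1ℚ , refl) , optimal-≤1) , (λ σ _ → some-load-≥1 durations durations-≥1 σ)

    picked⇒long : ∀ j → T (picked K (fibre assigned i*) j) → durations j ≡ R
    picked⇒long j p with longLabel j
    ... | just _ = refl

    long-alive : ∀ j → T (picked K (fibre assigned i*) j) → T (alive (job I j) R)
    long-alive j p = from (alive⇔ (job I j) R) (toℕ<n (quotient {R} K j) ,
      subst (λ d → R ℕ.≤ arrivalOf j ℕ.+ d) (sym (picked⇒long j p)) (ℕ.m≤n+m R (arrivalOf j)))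

    algorithm-≥K : ℕtoℚ K ≤ machineLoad I (runAlg A I) i* R
    algorithm-≥K = subst (ℕtoℚ K ≤_) (sym (machineLoad≡count durations assigned i* R))
      (ℕtoℚ-mono-≤ (ℕ.≤-trans (count-picked K (fibre assigned i*) (proj₂ crowded))
        (count-mono _ _ λ j p → from T-∧ (picked⇒T K (fibre assigned i*) j p , long-alive j p))))

lemma6 : ∃ λ (c : ℚ) → 0ℚ < c × (∀ (μ : ℚ) → 1ℚ ≤ μ →
             ∀ (A : (m : ℕ) → OblAlg (suc m)) →
             ∃ λ (m : ℕ) → ∃ λ (I : Instance (suc m)) → ∃ λ (μ₁ : ℚ) → ∃ λ (μ₂ : ℚ) →
               1ℚ ≤ μ₁ × 1ℚ ≤ μ₂ × μ₁ * μ₂ ≡ μ × Valid I × Consistent μ₁ μ₂ I ×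
               (∃ λ (v : ℚ) → 0ℚ < v × IsOpt I v × ObjAtLeast I (runAlg (A m) I) (c * μ * v)))
lemma6 = ⅓ , ℚ.positive⁻¹ ⅓ , λ μ 1≤μ A →
  let k , R≤μ , μ≤3K = μ-bracket μ 1≤μ
      open Adversary k
      open Against (A (k ℕ.+ K))
  in  k ℕ.+ K , I , μ , 1ℚ , 1≤μ , ℚ.≤-refl , ℚ.*-identityʳ μ ,
      valid durations durations-≥1 , consistent durations durations-≥1 durations-≤R R≤μ ,
      1ℚ , ℚ.positive⁻¹ 1ℚ , isOpt ,
      inj₂ (R , i* , ℚ.≤-trans (ℚ.≤-reflexive (ℚ.*-identityʳ (⅓ * μ))) (ℚ.≤-trans (⅓*≤ K μ≤3K) algorithm-≥K))
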